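{- Let $S$ be a well-behaved augmented PLTL-clause set and let $T$ be obtained from $S$ by one application of the temporal resolution operation (i.e. by adding the loop resolvents for some sometime clause $C\Rightarrow\Diamond l$ of $S$ and some loop in $\neg l$). Then (1) $T$ is well-behaved, and (2) if $S$ is satisfiable then $T$ is satisfiable.
   Context: PLTL formulae are built from proposition symbols, $\mathbf{true}$, $\mathbf{false}$, $\neg,\vee,\wedge,\Rightarrow$ and temporal operators $\bigcirc$ (next), $\Diamond$ (sometime), $\Box$ (always), $\mathcal{U}$ (until), $\mathcal{W}$ (unless). A model is an infinite sequence $\sigma=s_0,s_1,\dots$ of sets of proposition symbols; $(\sigma,i)\models p$ iff $p\in s_i$; Boolean connectives as usual; $\bigcirc A$ holds at $i$ iff $A$ holds at $i+1$; $\Diamond A$ at $i$ iff $A$ at some $k\ge i$; $\Box A$ at $i$ iff $A$ at all $j\ge i$; $A\,\mathcal{U}\,B$ at $i$ iff $B$ at some $k\ge i$ and $A$ at all $j$ with $i\le j<k$; $A\,\mathcal{W}\,B$ iff $A\,\mathcal{U}\,B$ or $\Box A$. $\mathbf{start}$ holds exactly at index $0$. Satisfiable means true at index $0$ of some model. A literal is a proposition symbol or its negation. A PLTL-clause has one of the forms $\mathbf{start}\Rightarrow\bigvee_c l_c$ (initial), $\bigwedge_a k_a\Rightarrow\bigcirc\bigvee_d l_d$ (step), $\bigwedge_b k_b\Rightarrow\Diamond l$ (sometime), all $k,l$ literals. A set $\{A_i\}$ of PLTL-clauses denotes $\Box\bigwedge_i A_i$. The literal $l$ of a sometime clause is an eventuality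 literal. For a conjunction of literals $C$, $\neg C$ is the disjunction of complementary literals. Augmentation: for a finite clause set $S_0$, $Aug(S_0)$ introduces for each eventuality literal $l$ a new proposition symbol $w_l$, and adds $w_l\Rightarrow\bigcirc(l\vee w_l)$ and, for each sometime clause $C\Rightarrow\Diamond l$, the clauses $\mathbf{start}\Rightarrow\neg C\vee l\vee w_l$ and $\mathbf{true}\Rightarrow\bigcirc(\neg C\vee l\vee w_l)$. An augmented PLTL-clause set is a set $Aug(S_0)$, possibly extended by clauses derived by the resolution rules (without new symbols). A normal model is a model satisfying $\Box(w_l\Leftrightarrow(\neg l\wedge\Diamond l))$ for each eventuality literal $l$; an augmented set is well-behaved if it is unsatisfiable or has a normal model. SNF$_m$ clauses: every step clause is one, and from $A\Rightarrow\bigcirc C$, $B\Rightarrow\bigcirc D$ one forms $(A\wedge B)\Rightarrow\bigcirc(C\wedge D)$. A loop in $\neg l$ is a family of SNF$_m$ clauses $A_i\Rightarrow\bigcirc B_i$ ($0\le i\le n$) formed by merging step clauses of the set such that, for all $i$, $B_i\Rightarrow\neg l$ and $B_i\Rightarrow\bigvee_{j=0}^n A_j$ are propositional tautologies. The loop resolvents for $C\Rightarrow\Diamond l$ and this loop are, for each $i$: $\mathbf{start}\Rightarrow\neg C\vee l\vee\neg A_i$, $\mathbf{true}\Rightarrow\bigcirc(\neg C\vee l\vee\neg A_i)$, $w_l\Rightarrow\bigcirc(l\vee\neg A_i)$. -}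

module Defs where

open import Data.Nat using (ℕ; zero; suc; _≤_)
open import Data.Bool using (Bool; true; false)
open import Data.List using (List; []; _∷_; _++_; map; concatMap)
open import Data.List.Relation.Unary.All using (All)
open import Data.List.Relation.Unary.Any using (Any)
open import Data.List.Membership.Propositional using (_∈_)
open import Data.Product using (Σ; ∃; _×_; _,_)
open import Data.Sum using (_⊎_)
open import Relation.Nullary using (¬_)
open import Relation.Binary.PropositionalEquality using (_≡_)

Sym : Set
Sym = ℕ

data Lit : Set where
  pos : Sym → Lit
  neg : Sym → Lit

compl : Lit → Lit
compl (pos p) = neg p
compl (neg p) = pos p

-- a conjunction of literals (empty list = true)
Conj : Set
Conj = List Lit

-- a disjunction of literals (empty list = false)
Disj : Set
Disj = List Lit

negC : Conj → Disj
negC = map compl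

data Clause : Set where
  initial  : Disj → Clause          -- start ⇒ ⋁ l
  step     : Conj → Disj → Clause   -- ⋀ k ⇒ ○ ⋁ l   (true ⇒ ... : empty Conj)
  sometime : Conj → Lit → Clause    -- ⋀ k ⇒ ◇ l

-- a finite clause set (denoting □ of the conjunction of its members)
ClauseSet : Set
ClauseSet = List Clause

Model : Set
Model = ℕ → Sym → Bool

_,_⊨L_ : Model → ℕ → Lit → Set
σ , i ⊨L pos p = σ i p ≡ true
σ , i ⊨L neg p = σ i p ≡ false

_,_⊨C_ : Model → ℕ → Conj → Set
σ , i ⊨C C = All (λ k → σ , i ⊨L k) C

_,_⊨D_ : Model → ℕ → Disj → Set
σ , i ⊨D D = Any (λ k → σ , i ⊨L k) D

-- truth of a clause at index i ('start' holds exactly at index 0)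
_,_⊨_ : Model → ℕ → Clause → Set
σ , i ⊨ initial D    = i ≡ 0 → σ , 0 ⊨D D
σ , i ⊨ step C D     = σ , i ⊨C C → σ , suc i ⊨D D
σ , i ⊨ sometime C l = σ , i ⊨C C → Σ ℕ λ k → i ≤ k × σ , k ⊨L l

Models : Model → ClauseSet → Set
Models σ S = (i : ℕ) → All (λ c → σ , i ⊨ c) S

Satisfiable : ClauseSet → Set
Satisfiable S = ∃ λ σ → Models σ S

litSym : Lit → Sym
litSym (pos p) = p
litSym (neg p) = p

OccursLs : Sym → List Lit → Set
OccursLs p ls = Any (λ k → litSym k ≡ p) ls

OccursCl : Sym → Clause → Set
OccursCl p (initial D)    = OccursLs p D
OccursCl p (step C D)     = OccursLs p C ⊎ OccursLs p D
OccursCl p (sometime C l) = OccursLs p C ⊎ litSym l ≡ p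

Occurs : Sym → ClauseSet → Set
Occurs p S = Any (OccursCl p) S

Eventuality : ClauseSet → Lit → Set
Eventuality S l = ∃ λ C → sometime C l ∈ S


NotSometime : Clause → Set
NotSometime c = ¬ (∃ λ C → ∃ λ l → c ≡ sometime C l)

-- Augmentation.  w l is the new symbol w_l for the eventuality literal l.

augClause : (Lit → Sym) → Clause → ClauseSet
augClause w (sometime C l) =
  step (pos (w l) ∷ []) (l ∷ pos (w l) ∷ []) ∷
  initial (negC C ++ (l ∷ pos (w l) ∷ [])) ∷
  step [] (negC C ++ (l ∷ pos (w l) ∷ [])) ∷ []
augClause w _ = []

Aug : ClauseSet → (Lit → Sym) → ClauseSet
Aug S₀ w = S₀ ++ concatMap (augClause w) S₀

FreshAssignment : ClauseSet → (Lit → Sym) → Set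
FreshAssignment S₀ w =
  ((l l′ : Lit) → Eventuality S₀ l → Eventuality S₀ l′ → w l ≡ w l′ → l ≡ l′) ×
  ((l : Lit) → Eventuality S₀ l → ¬ Occurs (w l) S₀)

-- clauses added to Aug(S₀) by resolution: initial/step clauses with no new symbols
AdmissibleExtra : ClauseSet → (Lit → Sym) → ClauseSet → Set
AdmissibleExtra S₀ w E =
  All (λ c → NotSometime c × ((p : Sym) → OccursCl p c → Occurs p (Aug S₀ w))) E

_⇔_ : Set → Set → Set
A ⇔ B = (A → B) × (B → A)

Normal : ClauseSet → (Lit → Sym) → Model → Set
Normal S₀ w σ = (l : Lit) → Eventuality S₀ l → (i : ℕ) →
  (σ i (w l) ≡ true) ⇔ (¬ (σ , i ⊨L l) × Σ ℕ λ k → i ≤ k × σ , k ⊨L l)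

WellBehaved : ClauseSet → (Lit → Sym) → ClauseSet → Set
WellBehaved S₀ w S = ¬ Satisfiable S ⊎ (∃ λ σ → Models σ S × Normal S₀ w σ)

-- conjunction of disjunctions (the right-hand side of an SNF_m clause)
CNF : Set
CNF = List Disj

-- SNF_m S A B : A ⇒ ○ B is an SNF_m clause formed from step clauses of S
data SNFm (S : ClauseSet) : Conj → CNF → Set where
  base  : ∀ {A D} → step A D ∈ S → SNFm S A (D ∷ [])
  merge : ∀ {A B C D} → SNFm S A C → SNFm S B D → SNFm S (A ++ B) (C ++ D)

Valuation : Set
Valuation = Sym → Bool

evL : Valuation → Lit → Set
evL v (pos p) = v p ≡ true
evL v (neg p) = v p ≡ false

evConj : Valuation → Conj → Set
evConj v C = All (evL v) C

evDisj : Valuation → Disj → Set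
evDisj v D = Any (evL v) D

evCNF : Valuation → CNF → Set
evCNF v B = All (evDisj v) B

-- a loop in ¬ l: a nonempty family (A_i ⇒ ○ B_i) of SNF_m clauses of S with
-- B_i ⇒ ¬ l and B_i ⇒ ⋁_j A_j propositional tautologies
Loop : ClauseSet → Lit → List (Conj × CNF) → Set
Loop S l L =
  ¬ (L ≡ []) ×
  All (λ { (A , B) → SNFm S A B ×
            ((v : Valuation) → evCNF v B → evL v (compl l)) ×
            ((v : Valuation) → evCNF v B → Any (λ { (A′ , _) → evConj v A′ }) L) }) L

loopResolvents : (Lit → Sym) → Conj → Lit → List (Conj × CNF) → ClauseSet
loopResolvents w C l L = concatMap res L
  where
  res : Conj × CNF → ClauseSet
  res (A , _) =
    initial (negC C ++ (l ∷ negC A)) ∷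
    step [] (negC C ++ (l ∷ negC A)) ∷
    step (pos (w l) ∷ []) (l ∷ negC A) ∷ []

{-# OPTIONS --safe #-}
-- Once some loop premise A_i holds at t, the loop keeps some A_j true, and ¬ l
-- true, at every later index.  So in a model of S, C ∧ ¬ l ∧ A_i at t would
-- contradict C ⇒ ◇ l; and in a normal model w_l at i (¬ l now, l later)
-- together with ¬ l ∧ A_i at i + 1 is impossible.  Hence every normal model of
-- S satisfies the loop resolvents, and both claims follow because a
-- well-behaved satisfiable set has a normal model.
module Submission where

open import Defs
open import Data.Bool using (true; false; _≟_)
open import Data.Bool.Properties using (not-¬; ¬-not)
open import Data.Empty using (⊥-elim)
open import Data.List using (List; []; _∷_; _++_)
open import Data.List.Membership.Propositional using (_∈_; _∉_; find; lose)
open import Data.List.Membership.Propositional.Properties using (∈-++⁻; ∈-concatMap⁻)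
open import Data.List.Relation.Unary.All as All using (All; []; _∷_)
open import Data.List.Relation.Unary.All.Properties using (++⁺; ++⁻ˡ; ++⁻ʳ)
open import Data.List.Relation.Unary.Any as Any using (Any; here; there)
open import Data.List.Relation.Unary.Any.Properties using (++⁺ˡ; ++⁺ʳ)
open import Data.Nat using (ℕ; suc; _≤_; _<_; s≤s; _≤′_; ≤′-refl; ≤′-step)
open import Data.Nat.Properties using (≤⇒≤′; m≤n⇒m<n∨m≡n; ≤∧≢⇒<)
open import Data.Product using (_×_; _,_; proj₁; proj₂)
open import Data.Sum using (inj₁; inj₂)
open import Function using (_∘_)
open import Relation.Nullary using (¬_; Dec; yes; no)
open import Relation.Binary.PropositionalEquality using (refl)

module _ {σ : Model} {i : ℕ} where

  ⊨L? : ∀ k → Dec (σ , i ⊨L k)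
  ⊨L? (pos p) = σ i p ≟ true
  ⊨L? (neg p) = σ i p ≟ false

  ⊨L-compl⇒¬⊨L : ∀ k → σ , i ⊨L compl k → ¬ σ , i ⊨L k
  ⊨L-compl⇒¬⊨L (pos p) = not-¬
  ⊨L-compl⇒¬⊨L (neg p) = not-¬

  ¬⊨L⇒⊨L-compl : ∀ k → ¬ σ , i ⊨L k → σ , i ⊨L compl k
  ¬⊨L⇒⊨L-compl (pos p) = ¬-not
  ¬⊨L⇒⊨L-compl (neg p) = ¬-not

  evL⇒⊨L : ∀ k → evL (σ i) k → σ , i ⊨L k
  evL⇒⊨L (pos p) x = x
  evL⇒⊨L (neg p) x = x

  ⊨L⇒evL : ∀ k → σ , i ⊨L k → evL (σ i) k
  ⊨L⇒evL (pos p) x = x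
  ⊨L⇒evL (neg p) x = x

  ⊨D-∷ : ∀ {k D} → (¬ σ , i ⊨L k → σ , i ⊨D D) → σ , i ⊨D (k ∷ D)
  ⊨D-∷ {k} ¬k⇒D with ⊨L? k
  ... | yes σ⊨k = here σ⊨k
  ... | no σ⊭k = there (¬k⇒D σ⊭k)

  ⊨D-negC : ∀ K → ¬ σ , i ⊨C K → σ , i ⊨D negC K
  ⊨D-negC [] σ⊭K = ⊥-elim (σ⊭K [])
  ⊨D-negC (k ∷ K) σ⊭k∷K with ⊨L? k
  ... | yes σ⊨k = there (⊨D-negC K (σ⊭k∷K ∘ (σ⊨k ∷_)))
  ... | no σ⊭k = here (¬⊨L⇒⊨L-compl k σ⊭k)

  ⊨D-negC-++ : ∀ K {D} → (σ , i ⊨C K → σ , i ⊨D D) → σ , i ⊨D (negC K ++ D)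
  ⊨D-negC-++ K K⇒D with All.all? ⊨L? K
  ... | yes σ⊨K = ++⁺ʳ (negC K) (K⇒D σ⊨K)
  ... | no σ⊭K = ++⁺ˡ (⊨D-negC K σ⊭K)

All-loopResolvents : ∀ {P : Clause → Set} w C l (L : List (Conj × CNF)) →
  (∀ {A B} → (A , B) ∈ L →
    P (initial (negC C ++ (l ∷ negC A))) ×
    P (step [] (negC C ++ (l ∷ negC A))) ×
    P (step (pos (w l) ∷ []) (l ∷ negC A))) →
  All P (loopResolvents w C l L)
All-loopResolvents w C l [] _ = []
All-loopResolvents w C l ((A , B) ∷ L) each with each (here refl)
... | p , q , r = p ∷ q ∷ r ∷ All-loopResolvents w C l L (each ∘ there)

SNFm-sound : ∀ {σ S A B} → Models σ S → SNFm S A B →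
  ∀ {t} → σ , t ⊨C A → evCNF (σ (suc t)) B
SNFm-sound σ⊨S (base A⇒○D) σ⊨A =
  Any.map (⊨L⇒evL _) (All.lookup (σ⊨S _) A⇒○D σ⊨A) ∷ []
SNFm-sound σ⊨S (merge {A} A⇒○C B⇒○D) σ⊨A∧B =
  ++⁺ (SNFm-sound σ⊨S A⇒○C (++⁻ˡ A σ⊨A∧B))
      (SNFm-sound σ⊨S B⇒○D (++⁻ʳ A σ⊨A∧B))

module _ {S : ClauseSet} {l : Lit} {L : List (Conj × CNF)} (loop : Loop S l L)
         {σ : Model} (σ⊨S : Models σ S) where

  LoopEntered : ℕ → Set
  LoopEntered t = Any (λ { (A , _) → σ , t ⊨C A }) L

  loop-step : ∀ {t} → LoopEntered t → σ , suc t ⊨L compl l × LoopEntered (suc t)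
  loop-step entered with find entered
  ... | (A , B) , AB∈L , σ⊨A with All.lookup (proj₂ loop) AB∈L
  ... | A⇒○B , B⇒¬l , B⇒⋁A =
    evL⇒⊨L (compl l) (B⇒¬l _ σ⊨B) , Any.map (All.map (evL⇒⊨L _)) (B⇒⋁A _ σ⊨B)
    where σ⊨B = SNFm-sound σ⊨S A⇒○B σ⊨A

  loop-persists : ∀ {t k} → LoopEntered t → t ≤′ k → LoopEntered k
  loop-persists entered ≤′-refl = entered
  loop-persists entered (≤′-step t≤k) = proj₂ (loop-step (loop-persists entered t≤k))

  loop-avoids : ∀ {t k} → LoopEntered t → t < k → ¬ σ , k ⊨L l
  loop-avoids entered (s≤s t≤k) =
    ⊨L-compl⇒¬⊨L l (proj₁ (loop-step (loop-persists entered (≤⇒≤′ t≤k))))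

  eventuality-now : ∀ {t k} → LoopEntered t → t ≤ k → σ , k ⊨L l → σ , t ⊨L l
  eventuality-now entered t≤k σ⊨l with m≤n⇒m<n∨m≡n t≤k
  ... | inj₁ t<k = ⊥-elim (loop-avoids entered t<k σ⊨l)
  ... | inj₂ refl = σ⊨l

  sometime-resolvent-holds : ∀ {C A B} → sometime C l ∈ S → (A , B) ∈ L → ∀ t →
    σ , t ⊨D (negC C ++ (l ∷ negC A))
  sometime-resolvent-holds {C} {A} C⇒◇l AB∈L t =
    ⊨D-negC-++ C λ σ⊨C → ⊨D-∷ λ σ⊭l → ⊨D-negC A λ σ⊨A →
      let _ , t≤k , σ⊨l = All.lookup (σ⊨S t) C⇒◇l σ⊨C
      in σ⊭l (eventuality-now (lose AB∈L σ⊨A) t≤k σ⊨l)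

  w-resolvent-holds : ∀ {A B i k} → (A , B) ∈ L →
    ¬ σ , i ⊨L l → i ≤ k → σ , k ⊨L l → σ , suc i ⊨D (l ∷ negC A)
  w-resolvent-holds {A} AB∈L σ⊭l i≤k σ⊨l =
    ⊨D-∷ λ σ⊭l′ → ⊨D-negC A λ σ⊨A →
      σ⊭l′ (eventuality-now (lose AB∈L σ⊨A) (≤∧≢⇒< i≤k λ { refl → σ⊭l σ⊨l }) σ⊨l)

  normal-model-loopResolvents : ∀ {S₀ w C} → sometime C l ∈ S → Eventuality S₀ l →
    Normal S₀ w σ → Models σ (S ++ loopResolvents w C l L)
  normal-model-loopResolvents {w = w} {C} C⇒◇l ev normal i =
    ++⁺ (σ⊨S i) (All-loopResolvents w C l L λ AB∈L →
      (λ { refl → sometime-resolvent-holds C⇒◇l AB∈L 0 }) ,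
      (λ _ → sometime-resolvent-holds C⇒◇l AB∈L (suc i)) ,
      λ { (σ⊨wₗ ∷ []) →
        let σ⊭l , _ , i≤k , σ⊨l = proj₁ (normal l ev i) σ⊨wₗ
        in w-resolvent-holds AB∈L σ⊭l i≤k σ⊨l })

augClause∌sometime : ∀ w c {C l} → sometime C l ∉ augClause w c
augClause∌sometime w (sometime _ _) (there (there (there ())))

sometime∈augmented⇒sometime∈S₀ : ∀ {S₀ w E C l} → AdmissibleExtra S₀ w E →
  sometime C l ∈ Aug S₀ w ++ E → sometime C l ∈ S₀
sometime∈augmented⇒sometime∈S₀ {S₀} {w} adm C⇒◇l with ∈-++⁻ (Aug S₀ w) C⇒◇l
... | inj₂ C⇒◇l∈E = ⊥-elim (proj₁ (All.lookup adm C⇒◇l∈E) (_ , _ , refl))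
... | inj₁ C⇒◇l∈Aug with ∈-++⁻ S₀ C⇒◇l∈Aug
...   | inj₁ C⇒◇l∈S₀ = C⇒◇l∈S₀
...   | inj₂ C⇒◇l∈aug =
  let c , C⇒◇l∈augc = Any.satisfied (∈-concatMap⁻ (augClause w) {S₀} C⇒◇l∈aug)
  in ⊥-elim (augClause∌sometime w c C⇒◇l∈augc)

module _ {S₀ : ClauseSet} {w : Lit → Sym} {S R : ClauseSet}
         (normal⇒R : ∀ {σ} → Models σ S → Normal S₀ w σ → Models σ (S ++ R)) where

  wellBehaved-++ : WellBehaved S₀ w S → WellBehaved S₀ w (S ++ R)
  wellBehaved-++ (inj₁ S-unsat) = inj₁ λ (σ , σ⊨S++R) → S-unsat (σ , ++⁻ˡ S ∘ σ⊨S++R)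
  wellBehaved-++ (inj₂ (σ , σ⊨S , normal)) = inj₂ (σ , normal⇒R σ⊨S normal , normal)

  satisfiable-++ : WellBehaved S₀ w S → Satisfiable S → Satisfiable (S ++ R)
  satisfiable-++ (inj₁ S-unsat) S-sat = ⊥-elim (S-unsat S-sat)
  satisfiable-++ (inj₂ (σ , σ⊨S , normal)) _ = σ , normal⇒R σ⊨S normal

lemma6 : (S₀ : ClauseSet) (w : Lit → Sym) → FreshAssignment S₀ w →
    (E : ClauseSet) → AdmissibleExtra S₀ w E →
    (C : Conj) (l : Lit) → sometime C l ∈ (Aug S₀ w ++ E) →
    (L : List (Conj × CNF)) → Loop (Aug S₀ w ++ E) l L →
    WellBehaved S₀ w (Aug S₀ w ++ E) →
    WellBehaved S₀ w ((Aug S₀ w ++ E) ++ loopResolvents w C l L)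
    × (Satisfiable (Aug S₀ w ++ E) → Satisfiable ((Aug S₀ w ++ E) ++ loopResolvents w C l L))
lemma6 S₀ w _ E adm C l C⇒◇l L loop well-behaved =
  wellBehaved-++ normal⇒resolvents well-behaved , satisfiable-++ normal⇒resolvents well-behaved
  where
  normal⇒resolvents : ∀ {σ} → Models σ (Aug S₀ w ++ E) → Normal S₀ w σ →
    Models σ ((Aug S₀ w ++ E) ++ loopResolvents w C l L)
  normal⇒resolvents σ⊨S =
    normal-model-loopResolvents loop σ⊨S C⇒◇l (C , sometime∈augmented⇒sometime∈S₀ adm C⇒◇l)
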